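{- Let $M_1=(U,\mathcal I_1),\ldots,M_k=(U,\mathcal I_k)$ be loopless matroids, let $R_c\subseteq U$, and let $G_c$ be a conflict graph for $R_c$ as described in the context. If $C_1,\ldots,C_s$ is a proper vertex coloring of $G_c$ with $s$ colors (i.e., a partition of $R_c$ into $s$ stable sets of $G_c$), then each $C_h$ lies in $\bigcap_{i\in[k]}\mathcal I_i$; that is, $C_1,\ldots,C_s$ is an $s$-coloring of $R_c$ by common independent sets of $M_1,\ldots,M_k$.
   Context: For a matroid $M$ with rank function $r$, a $k$-flexible decomposition of $S$ in $M$ is a partition $T_1,\ldots,T_\ell$ of $S$ such that $r(T_j)\ge|T_j|-k+1$ for all $j$ and, for any independent sets $I_j\subseteq T_j$, $\bigcup_jI_j$ is independent. Suppose for each $i\in[k]$, $T^i_1,\ldots,T^i_{\ell(i)}$ is a $k$-flexible decomposition of $R_c$ in $M_i$. For each $i$ and $j$, let $A^i_j\subseteq T^i_j$ be an $M_i$-independent set with $|A^i_j|\ge|T^i_j|-k+1$, and for each $e\in T^i_j\setminus A^i_j$ fix an element $e'\in A^i_j$ with $A^i_j\cup\{e\}\setminus\{e'\}\in\mathcal I_i$ (such an element exists, e.g., when $A^i_j$ is a maximal independent subset of $T^i_j$). The graph $H_i$ on vertex set $R_c$ has edge set consisting of all such pairs $\{e,e'\}$ together with all pairs of distinct elements of $T^i_j\setminus A^i_j$, over all $j\in[\ell(i)]$. The conflict graph is $G_c=(R_c,\bigcup_{i\in[k]}E(H_i))$. -}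

module Defs where

open import Data.Nat using (ℕ; _+_; _≤_; _<_)
open import Data.Fin using (Fin)
open import Data.Fin.Subset using (Subset; _∈_; _∉_; _⊆_; _∪_; _-_; ⁅_⁆; ⊥; ⋃; ∣_∣)
open import Data.List using (List)
open import Data.List.Base using (tabulate)
open import Data.Product using (Σ; ∃; _×_)
open import Data.Sum using (_⊎_)
open import Relation.Binary.PropositionalEquality using (_≡_; _≢_)
open import Relation.Nullary using (¬_)
open import Level using (suc; zero)

record Matroid (n : ℕ) : Set₁ where
  field
    Indep       : Subset n → Set
    indep-∅     : Indep ⊥
    indep-⊆     : ∀ {A B} → B ⊆ A → Indep A → Indep B
    indep-exch  : ∀ {A B} → Indep A → Indep B → ∣ A ∣ < ∣ B ∣ →
                  ∃ λ x → x ∈ B × x ∉ A × Indep (A ∪ ⁅ x ⁆)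

open Matroid public

Loopless : ∀ {n} → Matroid n → Set
Loopless {n} M = (x : Fin n) → Indep M ⁅ x ⁆

⋃ᶠ : ∀ {n ℓ} → (Fin ℓ → Subset n) → Subset n
⋃ᶠ T = ⋃ (tabulate T)

IsPartition : ∀ {n ℓ} → Subset n → (Fin ℓ → Subset n) → Set
IsPartition {n} {ℓ} S T =
  ((x : Fin n) → x ∈ S → ∃ λ j → x ∈ T j) ×
  ((j : Fin ℓ) → T j ⊆ S) ×
  ((x : Fin n) (j j′ : Fin ℓ) → x ∈ T j → x ∈ T j′ → j ≡ j′)

-- rank condition r(T) ≥ |T| - k + 1, with r(T) = max size of an
-- independent subset of T, written without truncated subtraction:
-- some independent I ⊆ T has |I| + k ≥ |T| + 1.
RankAtLeast : ∀ {n} → Matroid n → ℕ → Subset n → Set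
RankAtLeast M k T = ∃ λ I → I ⊆ T × Indep M I × ∣ T ∣ + 1 ≤ ∣ I ∣ + k

IsFlexibleDecomposition : ∀ {n ℓ} → ℕ → Matroid n → Subset n → (Fin ℓ → Subset n) → Set
IsFlexibleDecomposition {n} {ℓ} k M S T =
  IsPartition S T ×
  ((j : Fin ℓ) → RankAtLeast M k (T j)) ×
  ((I : Fin ℓ → Subset n) → ((j : Fin ℓ) → I j ⊆ T j) → ((j : Fin ℓ) → Indep M (I j)) →
     Indep M (⋃ᶠ I))

-- Data for the graph H_i on one decomposition: sets A_j and the chosen
-- exchange partners e ↦ e′ (σ j e, meaningful for e ∈ T_j ∖ A_j).
record ExchangeData {n ℓ : ℕ} (k : ℕ) (M : Matroid n) (T : Fin ℓ → Subset n) : Set where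
  field
    A      : Fin ℓ → Subset n
    A⊆T    : (j : Fin ℓ) → A j ⊆ T j
    A-ind  : (j : Fin ℓ) → Indep M (A j)
    A-big  : (j : Fin ℓ) → ∣ T j ∣ + 1 ≤ ∣ A j ∣ + k
    σ      : Fin ℓ → Fin n → Fin n
    σ∈A    : (j : Fin ℓ) (e : Fin n) → e ∈ T j → e ∉ A j → σ j e ∈ A j
    σ-exch : (j : Fin ℓ) (e : Fin n) → e ∈ T j → e ∉ A j →
             Indep M ((A j ∪ ⁅ e ⁆) - σ j e)

open ExchangeData public

HEdge : ∀ {n ℓ k} {M : Matroid n} {T : Fin ℓ → Subset n} →
        ExchangeData k M T → Fin n → Fin n → Set
HEdge {n} {ℓ} {T = T} D x y = ∃ λ (j : Fin ℓ) →
    (x ∈ T j × x ∉ A D j × y ≡ σ D j x)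
  ⊎ (y ∈ T j × y ∉ A D j × x ≡ σ D j y)
  ⊎ (x ∈ T j × x ∉ A D j × y ∈ T j × y ∉ A D j × x ≢ y)

IsProperColoring : ∀ {n s} → Subset n → (Fin n → Fin n → Set) → (Fin s → Subset n) → Set
IsProperColoring {n} R Adj C =
  IsPartition R C ×
  (∀ h (x y : Fin n) → x ∈ C h → y ∈ C h → ¬ Adj x y)

{-# OPTIONS --safe #-}
module Submission where

-- Fix a matroid M_i and a colour class C. A block T_j of the flexible
-- decomposition meets C in a set with at most one element outside A_j, since
-- any two such elements are adjacent in H_i. If there is none, C ∩ T_j ⊆ A_j;
-- if there is one, e, then its exchange partner e′ is adjacent to e, so
-- C ∩ T_j ⊆ (A_j ∪ {e}) ∖ {e′}. Either way C ∩ T_j is independent, and the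
-- flexibility of the decomposition makes the union C of these sets independent.

open import Defs
open import Data.Nat using (ℕ)
open import Data.Fin using (Fin; zero; suc; _≟_)
open import Data.Fin.Subset using (Subset; _∈_; _∉_; _∩_; _∪_; _-_; _⊆_; ⁅_⁆)
open import Data.Fin.Subset.Properties
  using (_∈?_; x∈p∩q⁺; x∈p∩q⁻; p∩q⊆q; x∈p∪q⁺; x∈⁅x⁆; x∈p∧x≢y⇒x∈p-y)
open import Data.Fin.Properties using (any?)
open import Data.Product using (∃; _,_)
open import Data.Sum using (inj₁; inj₂)
open import Relation.Nullary using (¬_; yes; no)
open import Relation.Nullary.Decidable using (decidable-stable; _×-dec_; ¬?)
open import Relation.Binary.PropositionalEquality using (_≢_; refl)

IsStableSet : ∀ {n} → (Fin n → Fin n → Set) → Subset n → Set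
IsStableSet Adj X = ∀ x y → x ∈ X → y ∈ X → ¬ Adj x y

x∈⋃ᶠ⁺ : ∀ {n ℓ} (I : Fin ℓ → Subset n) (j : Fin ℓ) {x : Fin n} → x ∈ I j → x ∈ ⋃ᶠ I
x∈⋃ᶠ⁺ I zero    x∈I = x∈p∪q⁺ (inj₁ x∈I)
x∈⋃ᶠ⁺ I (suc j) x∈I = x∈p∪q⁺ (inj₂ (x∈⋃ᶠ⁺ (λ j → I (suc j)) j x∈I))

partition-⊆⋃ᶠ∩ : ∀ {n ℓ} {S X : Subset n} {T : Fin ℓ → Subset n} →
                 IsPartition S T → X ⊆ S → X ⊆ ⋃ᶠ (λ j → X ∩ T j)
partition-⊆⋃ᶠ∩ (covers , _ , _) X⊆S {x} x∈X with covers x (X⊆S x∈X)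
... | j , x∈T = x∈⋃ᶠ⁺ _ j (x∈p∩q⁺ (x∈X , x∈T))

flexible-indep : ∀ {n ℓ k} {M : Matroid n} {S X : Subset n} {T : Fin ℓ → Subset n} →
                 IsFlexibleDecomposition k M S T → X ⊆ S →
                 ((j : Fin ℓ) → Indep M (X ∩ T j)) → Indep M X
flexible-indep {M = M} {X = X} {T} (partition , _ , union-indep) X⊆S X∩T-indep =
  indep-⊆ M (partition-⊆⋃ᶠ∩ partition X⊆S)
    (union-indep (λ j → X ∩ T j) (λ j → p∩q⊆q X (T j)) X∩T-indep)

module _ {n ℓ k} {M : Matroid n} {T : Fin ℓ → Subset n} (D : ExchangeData k M T)
         {X : Subset n} (stable : IsStableSet (HEdge D) X) (j : Fin ℓ) where

  ∩block-⊆A : (∀ e → e ∈ X → e ∈ T j → e ∈ A D j) → X ∩ T j ⊆ A D j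
  ∩block-⊆A inside-A x∈X∩T with x∈p∩q⁻ X (T j) x∈X∩T
  ... | x∈X , x∈T = inside-A _ x∈X x∈T

  ∩block-⊆exchange : ∀ {e} → e ∈ X → e ∈ T j → e ∉ A D j →
                     X ∩ T j ⊆ (A D j ∪ ⁅ e ⁆) - σ D j e
  ∩block-⊆exchange {e} e∈X e∈T e∉A {x} x∈X∩T with x∈p∩q⁻ X (T j) x∈X∩T
  ... | x∈X , x∈T = x∈p∧x≢y⇒x∈p-y x∈A∪e x≢e′
    where
    x∈A∪e : x ∈ A D j ∪ ⁅ e ⁆
    x∈A∪e with x ∈? A D j
    ... | yes x∈A = x∈p∪q⁺ (inj₁ x∈A)
    ... | no x∉A with refl ← decidable-stable (x ≟ e)
                        (λ x≢e → stable x e x∈X e∈X (j , inj₂ (inj₂ (x∈T , x∉A , e∈T , e∉A , x≢e))))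
      = x∈p∪q⁺ (inj₂ (x∈⁅x⁆ x))
    x≢e′ : x ≢ σ D j e
    x≢e′ x≡e′ = stable e x e∈X x∈X (j , inj₁ (e∈T , e∉A , x≡e′))

  stable∩block-indep : Indep M (X ∩ T j)
  stable∩block-indep
    with any? (λ e → (e ∈? X) ×-dec (e ∈? T j) ×-dec ¬? (e ∈? A D j))
  ... | yes (e , e∈X , e∈T , e∉A) =
    indep-⊆ M (∩block-⊆exchange e∈X e∈T e∉A) (σ-exch D j e e∈T e∉A)
  ... | no none = indep-⊆ M (∩block-⊆A inside-A) (A-ind D j)
    where
    inside-A : ∀ e → e ∈ X → e ∈ T j → e ∈ A D j
    inside-A e e∈X e∈T = decidable-stable (e ∈? A D j) (λ e∉A → none (e , e∈X , e∈T , e∉A))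

stable-indep : ∀ {n ℓ k} {M : Matroid n} {S X : Subset n} {T : Fin ℓ → Subset n} →
               IsFlexibleDecomposition k M S T → (D : ExchangeData k M T) →
               IsStableSet (HEdge D) X → X ⊆ S → Indep M X
stable-indep {k = k} {M} {S} {X} {T} flexible D stable X⊆S =
  flexible-indep {k = k} {M} {S} {X} {T} flexible X⊆S (stable∩block-indep D {X} stable)

lemma4p7 : (n k : ℕ) (M : Fin k → Matroid n) → ((i : Fin k) → Loopless (M i)) →
           (Rc : Subset n) →
           (ℓ : Fin k → ℕ) (T : (i : Fin k) → Fin (ℓ i) → Subset n) →
           ((i : Fin k) → IsFlexibleDecomposition k (M i) Rc (T i)) →
           (D : (i : Fin k) → ExchangeData k (M i) (T i)) →
           (s : ℕ) (C : Fin s → Subset n) →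
           IsProperColoring Rc (λ x y → ∃ λ i → HEdge (D i) x y) C →
           (h : Fin s) (i : Fin k) → Indep (M i) (C h)
lemma4p7 n k M _ Rc ℓ T flexible D s C ((_ , C⊆Rc , _) , stable) h i =
  stable-indep (flexible i) (D i) stable-in-Hᵢ (C⊆Rc h)
  where
  stable-in-Hᵢ : IsStableSet (HEdge (D i)) (C h)
  stable-in-Hᵢ x y x∈C y∈C edge = stable h x y x∈C y∈C (i , edge)
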